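{- A point $y\in \mathrm{PG}(5,q)$ belongs to $\mathcal{P}_{2,e}$ if and only if $|M_y|=0$ and $-|M_{11}(M_y)|$, $-|M_{22}(M_y)|$, $-|M_{33}(M_y)|$ are all squares in $\mathbb{F}_q$ with at least one being non-zero.
   Context: $q$ is odd. Points $y=(y_0,\dots,y_5)$ of $\mathrm{PG}(5,q)$ are represented by symmetric matrices $M_y=\begin{pmatrix} y_0&y_1&y_2\\ y_1&y_3&y_4\\ y_2&y_4&y_5\end{pmatrix}$; the rank of $y$ is the rank of $M_y$. The quadric Veronesean $\mathcal{V}(\mathbb{F}_q)$ is the set of rank-1 points (all $2\times2$ minors zero). Each rank-2 point $z$ lies in a unique conic plane $\langle\mathcal{C}_z\rangle$, where $\mathcal{C}_z$ is a conic contained in $\mathcal{V}(\mathbb{F}_q)$ (image under the Veronese map of a line of $\mathrm{PG}(2,q)$). $\mathcal{P}_{2,e}$ is the set of rank-2 points $z$ lying on a tangent line to $\mathcal{C}_z$ (exterior points). $M_{ij}(A)$ is the matrix obtained from $A$ by deleting row $i$ and column $j$, and $|\cdot|$ is the determinant. -}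

module Defs where

open import Level using (0ℓ)
open import Data.Nat using (ℕ)
open import Data.Fin using (Fin; zero; suc; punchIn)
open import Data.Product using (Σ; ∃; _×_; _,_; proj₁; proj₂)
open import Data.Sum using (_⊎_)
open import Data.List using (List; []; _∷_; map; foldr)
open import Data.List.Relation.Unary.All using (All)
open import Relation.Binary.PropositionalEquality using (_≡_)
open import Relation.Nullary using (¬_; Dec)
open import Algebra.Structures using (IsCommutativeRing)
open import Function.Bundles using (_⤖_)

record FiniteField : Set₁ where
  infixl 6 _+_
  infixl 7 _*_
  field
    Carrier : Set
    _+_ _*_ : Carrier → Carrier → Carrier
    -_ : Carrier → Carrier
    0# 1# : Carrier
    isCommutativeRing : IsCommutativeRing _≡_ _+_ _*_ -_ 0# 1#
    0≢1 : ¬ (0# ≡ 1#)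
    inverse : ∀ x → ¬ (x ≡ 0#) → Σ Carrier λ y → x * y ≡ 1#
    _≟_ : (x y : Carrier) → Dec (x ≡ y)
    q : ℕ
    enum : Fin q ⤖ Carrier

module FF (F : FiniteField) where
  open FiniteField F public

  _-_ : Carrier → Carrier → Carrier
  x - y = x + (- y)
  infixl 6 _-_

  IsSquare : Carrier → Set
  IsSquare x = Σ Carrier λ s → x ≡ s * s

  NonZero : Carrier → Set
  NonZero x = ¬ (x ≡ 0#)

  Vector : ℕ → Set
  Vector n = Fin n → Carrier

  Mat : ℕ → Set
  Mat n = Fin n → Fin n → Carrier

  _≐_ : ∀ {n} → Vector n → Vector n → Set
  u ≐ v = ∀ k → u k ≡ v k

  NonZeroVec : ∀ {n} → Vector n → Set
  NonZeroVec v = ¬ (∀ k → v k ≡ 0#)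

  -- w and p represent the same projective point (w is a scalar multiple of p)
  SamePoint : ∀ {n} → Vector n → Vector n → Set
  SamePoint w p = Σ Carrier λ c → ∀ k → w k ≡ c * p k

  M : Vector 6 → Mat 3
  M y zero zero = y zero
  M y zero (suc zero) = y (suc zero)
  M y zero (suc (suc zero)) = y (suc (suc zero))
  M y (suc zero) zero = y (suc zero)
  M y (suc zero) (suc zero) = y (suc (suc (suc zero)))
  M y (suc zero) (suc (suc zero)) = y (suc (suc (suc (suc zero))))
  M y (suc (suc zero)) zero = y (suc (suc zero))
  M y (suc (suc zero)) (suc zero) = y (suc (suc (suc (suc zero))))
  M y (suc (suc zero)) (suc (suc zero)) = y (suc (suc (suc (suc (suc zero)))))

  minor : Fin 3 → Fin 3 → Mat 3 → Mat 2
  minor i j A r c = A (punchIn i r) (punchIn j c)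

  det2 : Mat 2 → Carrier
  det2 A = A zero zero * A (suc zero) (suc zero) - A zero (suc zero) * A (suc zero) zero

  det3 : Mat 3 → Carrier
  det3 A = A zero zero * det2 (minor zero zero A)
         - A zero (suc zero) * det2 (minor zero (suc zero) A)
         + A zero (suc (suc zero)) * det2 (minor zero (suc (suc zero)) A)

  -- rank of a point of PG(5,q) (y nonzero) via minors
  Rank1 : Vector 6 → Set
  Rank1 y = NonZeroVec y × (∀ i j → det2 (minor i j (M y)) ≡ 0#)

  Rank2 : Vector 6 → Set
  Rank2 y = det3 (M y) ≡ 0# × Σ (Fin 3) λ i → Σ (Fin 3) λ j → NonZero (det2 (minor i j (M y)))

  -- Veronese map PG(2,q) → PG(5,q); M_{ν(x)} = x xᵀ
  ν : Vector 3 → Vector 6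
  ν x zero = x zero * x zero
  ν x (suc zero) = x zero * x (suc zero)
  ν x (suc (suc zero)) = x zero * x (suc (suc zero))
  ν x (suc (suc (suc zero))) = x (suc zero) * x (suc zero)
  ν x (suc (suc (suc (suc zero)))) = x (suc zero) * x (suc (suc zero))
  ν x (suc (suc (suc (suc (suc zero))))) = x (suc (suc zero)) * x (suc (suc zero))

  -- line of PG(2,q) with (nonzero) coordinates a: a0 x0 + a1 x1 + a2 x2 = 0
  OnLine : Vector 3 → Vector 3 → Set
  OnLine a x = a zero * x zero + a (suc zero) * x (suc zero) + a (suc (suc zero)) * x (suc (suc zero)) ≡ 0#

  -- w (a vector of F_q^6) represents a point of the conic C = ν(line a)
  OnConic : Vector 3 → Vector 6 → Set
  OnConic a w = Σ (Vector 3) λ x → NonZeroVec x × OnLine a x × (w ≐ ν x)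

  sumV : List (Carrier × Vector 6) → Vector 6
  sumV l k = foldr (λ p acc → proj₁ p * proj₂ p k + acc) 0# l

  InSpan : (Vector 6 → Set) → Vector 6 → Set
  InSpan S z = Σ (List (Carrier × Vector 6)) λ l → All (λ p → S (proj₂ p)) l × (z ≐ sumV l)

  OnLineThrough : Vector 6 → Vector 6 → Vector 6 → Set
  OnLineThrough p z w = Σ Carrier λ α → Σ Carrier λ β → ∀ k → w k ≡ α * p k + β * z k

  -- P_{2,e}: rank-2 points z lying on a tangent line of the conic C_z,
  -- where the conic plane ⟨C_z⟩ is the span of C_z = ν(L), L a line of PG(2,q);
  -- the tangent line through z is the line ⟨p , z⟩ with p ∈ C_z meeting C_z only in p.
  P2e : Vector 6 → Set
  P2e z = Rank2 z × Σ (Vector 3) λ a → NonZeroVec a × InSpan (OnConic a) z ×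
          Σ (Vector 6) λ p → OnConic a p ×
            (∀ w → OnConic a w → OnLineThrough p z w → SamePoint w p)

module Submission where

-- Both directions pass through one normal form: c·M_y = l xxᵀ + x eᵀ + e xᵀ
-- with c ≢ 0 and x × e ≢ 0, where x × e is the line of PG(2,q) whose conic
-- plane contains y and ν x is the point of tangency.  Its 2×2 minors are
-- -πᵢπⱼ, with πᵢ the minors of the 3×2 matrix [x e]; this gives the squares.
-- Forward: with the line written as x × d, the span of its conic consists of
-- the matrices α xxᵀ + β (x dᵀ + d xᵀ) + γ ddᵀ, and tangency at ν x forces
-- γ = 0.  Backward: the normal form is written down explicitly after moving
-- the non-zero principal minor to rows 0, 1; tangency follows by evaluating
-- quadratic forms.

open import Defs
open import Level using (0ℓ)
open import Algebra.Core using (Op₁; Op₂)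
open import Algebra.Bundles using (CommutativeRing; RawRing)
open import Algebra.Structures using (IsCommutativeRing)
open import Algebra.Solver.Ring.AlmostCommutativeRing using (fromCommutativeRing; _-Raw-AlmostCommutative⟶_)
open import Data.Nat as ℕ using (ℕ; zero; suc; _∸_; _%_)
import Data.Nat.Properties as ℕ
open import Data.Fin using (Fin; zero; suc; punchIn; inject₁; #_)
open import Data.Product using (Σ; _×_; _,_; proj₁; proj₂)
open import Data.Sum using (_⊎_; inj₁; inj₂; [_,_])
open import Data.Empty using (⊥; ⊥-elim)
open import Data.Maybe using (Maybe; just; nothing)
open import Data.Vec using (Vec; []; _∷_)
open import Data.List using (List; []; _∷_)
open import Data.List.Relation.Unary.All using (All; []; _∷_)
open import Function.Bundles using (_⇔_; mk⇔)
open import Relation.Nullary using (yes; no)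
open import Relation.Binary.PropositionalEquality using (_≡_; refl; sym; trans; cong; cong₂; module ≡-Reasoning)

-- An integer is a formal difference (a , b)
-- of naturals, read as a - b and kept in the normal form where one side
-- is zero, so that equal coefficients are syntactically equal.
module IntegerCoefficientSolver
  {Carrier : Set} {add mul : Op₂ Carrier} {neg : Op₁ Carrier} {zer one : Carrier}
  (isCommutativeRing : IsCommutativeRing _≡_ add mul neg zer one) where

  commutativeRing : CommutativeRing 0ℓ 0ℓ
  commutativeRing = record { isCommutativeRing = isCommutativeRing }

  open CommutativeRing commutativeRing
    using (_+_; _*_; -_; _-_; 0#; 1#; +-assoc; +-comm; +-identityˡ; +-identityʳ; *-identityˡ;
           zeroˡ; distribʳ; -‿inverseʳ; ring; +-commutativeSemigroup)
  open import Algebra.Properties.Ring ring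
    using (-0#≈0#; -‿+-comm; ⁻¹-anti-homo‿-; x[y-z]≈xy-xz; [y-z]x≈yx-zx)
  open import Algebra.Properties.CommutativeSemigroup +-commutativeSemigroup using (interchange)
  open ≡-Reasoning

  private
    sub-+ : ∀ p q r s → (p + r) - (q + s) ≡ (p - q) + (r - s)
    sub-+ p q r s = begin
      (p + r) + - (q + s)      ≡⟨ cong ((p + r) +_) (sym (-‿+-comm q s)) ⟩
      (p + r) + (- q + - s)    ≡⟨ interchange p r (- q) (- s) ⟩
      (p - q) + (r - s)        ∎

    sub-cancel : ∀ u p q → (u + p) - (u + q) ≡ p - q
    sub-cancel u p q = begin
      (u + p) - (u + q)        ≡⟨ sub-+ u u p q ⟩
      (u - u) + (p - q)        ≡⟨ cong (_+ (p - q)) (-‿inverseʳ u) ⟩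
      0# + (p - q)             ≡⟨ +-identityˡ (p - q) ⟩
      p - q                    ∎

    sub-sub : ∀ p q r s → (p - q) - (r - s) ≡ (p + s) - (q + r)
    sub-sub p q r s = begin
      (p - q) + - (r - s)      ≡⟨ cong ((p - q) +_) (⁻¹-anti-homo‿- r s) ⟩
      (p + - q) + (s + - r)    ≡⟨ interchange p (- q) s (- r) ⟩
      (p + s) + (- q + - r)    ≡⟨ cong ((p + s) +_) (-‿+-comm q r) ⟩
      (p + s) - (q + r)        ∎

  -- the image of a natural number; 0 and 1 go to 0# and 1# on the nose
  fromℕ : ℕ → Carrier
  fromℕ zero = 0#
  fromℕ (suc zero) = 1#
  fromℕ (suc (suc n)) = 1# + fromℕ (suc n)

  fromℕ-suc : ∀ n → fromℕ (suc n) ≡ 1# + fromℕ n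
  fromℕ-suc zero = sym (+-identityʳ 1#)
  fromℕ-suc (suc n) = refl

  fromℕ-+ : ∀ m n → fromℕ (m ℕ.+ n) ≡ fromℕ m + fromℕ n
  fromℕ-+ zero n = sym (+-identityˡ (fromℕ n))
  fromℕ-+ (suc m) n = begin
    fromℕ (suc (m ℕ.+ n))        ≡⟨ fromℕ-suc (m ℕ.+ n) ⟩
    1# + fromℕ (m ℕ.+ n)         ≡⟨ cong (1# +_) (fromℕ-+ m n) ⟩
    1# + (fromℕ m + fromℕ n)     ≡⟨ sym (+-assoc 1# (fromℕ m) (fromℕ n)) ⟩
    (1# + fromℕ m) + fromℕ n     ≡⟨ cong (_+ fromℕ n) (sym (fromℕ-suc m)) ⟩
    fromℕ (suc m) + fromℕ n      ∎

  fromℕ-* : ∀ m n → fromℕ (m ℕ.* n) ≡ fromℕ m * fromℕ n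
  fromℕ-* zero n = sym (zeroˡ (fromℕ n))
  fromℕ-* (suc m) n = begin
    fromℕ (n ℕ.+ m ℕ.* n)             ≡⟨ fromℕ-+ n (m ℕ.* n) ⟩
    fromℕ n + fromℕ (m ℕ.* n)         ≡⟨ cong₂ _+_ (sym (*-identityˡ (fromℕ n))) (fromℕ-* m n) ⟩
    1# * fromℕ n + fromℕ m * fromℕ n  ≡⟨ sym (distribʳ (fromℕ n) 1# (fromℕ m)) ⟩
    (1# + fromℕ m) * fromℕ n          ≡⟨ cong (_* fromℕ n) (sym (fromℕ-suc m)) ⟩
    fromℕ (suc m) * fromℕ n           ∎

  normal : ℕ × ℕ → ℕ × ℕ
  normal (a , b) = (a ∸ b , b ∸ a)

  ℤ : RawRing 0ℓ 0ℓ
  ℤ = record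
    { Carrier = ℕ × ℕ ; _≈_ = _≡_
    ; _+_ = λ { (a , b) (c , d) → normal (a ℕ.+ c , b ℕ.+ d) }
    ; _*_ = λ { (a , b) (c , d) → normal (a ℕ.* c ℕ.+ b ℕ.* d , a ℕ.* d ℕ.+ b ℕ.* c) }
    ; -_ = λ { (a , b) → (b , a) }
    ; 0# = (0 , 0) ; 1# = (1 , 0) }

  -- the value of a formal difference; it is 0# and 1# on the nose for the
  -- constants (0 , 0) and (1 , 0), so formal constants evaluate as expected
  ⟦_⟧ℤ : ℕ × ℕ → Carrier
  ⟦ a , zero ⟧ℤ = fromℕ a
  ⟦ zero , suc b ⟧ℤ = - fromℕ (suc b)
  ⟦ suc a , suc b ⟧ℤ = ⟦ a , b ⟧ℤ

  ℤ-difference : ∀ a b → ⟦ a , b ⟧ℤ ≡ fromℕ a - fromℕ b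
  ℤ-difference a zero = sym (trans (cong (fromℕ a +_) -0#≈0#) (+-identityʳ (fromℕ a)))
  ℤ-difference zero (suc b) = sym (+-identityˡ (- fromℕ (suc b)))
  ℤ-difference (suc a) (suc b) = begin
    ⟦ a , b ⟧ℤ                              ≡⟨ ℤ-difference a b ⟩
    fromℕ a - fromℕ b                      ≡⟨ sym (sub-cancel 1# (fromℕ a) (fromℕ b)) ⟩
    (1# + fromℕ a) - (1# + fromℕ b)        ≡⟨ sym (cong₂ _-_ (fromℕ-suc a) (fromℕ-suc b)) ⟩
    fromℕ (suc a) - fromℕ (suc b)          ∎

  ℤ-cong : ∀ a b c d → a ℕ.+ d ≡ c ℕ.+ b → ⟦ a , b ⟧ℤ ≡ ⟦ c , d ⟧ℤ
  ℤ-cong a b c d eq = begin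
    ⟦ a , b ⟧ℤ                  ≡⟨ ℤ-difference a b ⟩
    A - B                      ≡⟨ sym (sub-cancel D A B) ⟩
    (D + A) - (D + B)          ≡⟨ cong₂ _-_ (+-comm D A) (+-comm D B) ⟩
    (A + D) - (B + D)          ≡⟨ cong (_- (B + D)) (trans (sym (fromℕ-+ a d)) (trans (cong fromℕ eq) (fromℕ-+ c b))) ⟩
    (C + B) - (B + D)          ≡⟨ cong (_- (B + D)) (+-comm C B) ⟩
    (B + C) - (B + D)          ≡⟨ sub-cancel B C D ⟩
    C - D                      ≡⟨ sym (ℤ-difference c d) ⟩
    ⟦ c , d ⟧ℤ                  ∎
    where
      A B C D : Carrier
      A = fromℕ a
      B = fromℕ b
      C = fromℕ c
      D = fromℕ d

  ℤ-normal : ∀ a b → ⟦ a ∸ b , b ∸ a ⟧ℤ ≡ ⟦ a , b ⟧ℤ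
  ℤ-normal a b = ℤ-cong (a ∸ b) (b ∸ a) a b (balance a b)
    where
      balance : ∀ a b → (a ∸ b) ℕ.+ b ≡ a ℕ.+ (b ∸ a)
      balance zero zero = refl
      balance zero (suc b) = refl
      balance (suc a) zero = refl
      balance (suc a) (suc b) = trans (ℕ.+-suc (a ∸ b) b) (cong suc (balance a b))

  homomorphism : ℤ -Raw-AlmostCommutative⟶ fromCommutativeRing commutativeRing
  homomorphism = record
    { ⟦_⟧ = ⟦_⟧ℤ
    ; +-homo = λ { (a , b) (c , d) → begin
        ⟦ normal (a ℕ.+ c , b ℕ.+ d) ⟧ℤ                      ≡⟨ ℤ-normal (a ℕ.+ c) (b ℕ.+ d) ⟩
        ⟦ a ℕ.+ c , b ℕ.+ d ⟧ℤ                              ≡⟨ ℤ-difference (a ℕ.+ c) (b ℕ.+ d) ⟩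
        fromℕ (a ℕ.+ c) - fromℕ (b ℕ.+ d)                  ≡⟨ cong₂ _-_ (fromℕ-+ a c) (fromℕ-+ b d) ⟩
        (fromℕ a + fromℕ c) - (fromℕ b + fromℕ d)          ≡⟨ sub-+ (fromℕ a) (fromℕ b) (fromℕ c) (fromℕ d) ⟩
        (fromℕ a - fromℕ b) + (fromℕ c - fromℕ d)          ≡⟨ sym (cong₂ _+_ (ℤ-difference a b) (ℤ-difference c d)) ⟩
        ⟦ a , b ⟧ℤ + ⟦ c , d ⟧ℤ                              ∎ }
    ; *-homo = λ { (a , b) (c , d) → let A = fromℕ a ; B = fromℕ b ; C = fromℕ c ; D = fromℕ d in begin
        ⟦ normal (a ℕ.* c ℕ.+ b ℕ.* d , a ℕ.* d ℕ.+ b ℕ.* c) ⟧ℤ ≡⟨ ℤ-normal (a ℕ.* c ℕ.+ b ℕ.* d) (a ℕ.* d ℕ.+ b ℕ.* c) ⟩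
        ⟦ a ℕ.* c ℕ.+ b ℕ.* d , a ℕ.* d ℕ.+ b ℕ.* c ⟧ℤ      ≡⟨ ℤ-difference (a ℕ.* c ℕ.+ b ℕ.* d) (a ℕ.* d ℕ.+ b ℕ.* c) ⟩
        fromℕ (a ℕ.* c ℕ.+ b ℕ.* d) - fromℕ (a ℕ.* d ℕ.+ b ℕ.* c)
          ≡⟨ cong₂ _-_ (trans (fromℕ-+ (a ℕ.* c) (b ℕ.* d)) (cong₂ _+_ (fromℕ-* a c) (fromℕ-* b d)))
                       (trans (fromℕ-+ (a ℕ.* d) (b ℕ.* c)) (cong₂ _+_ (fromℕ-* a d) (fromℕ-* b c))) ⟩
        (A * C + B * D) - (A * D + B * C)                  ≡⟨ sym (sub-sub (A * C) (A * D) (B * C) (B * D)) ⟩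
        (A * C - A * D) - (B * C - B * D)                  ≡⟨ sym (cong₂ _-_ (x[y-z]≈xy-xz A C D) (x[y-z]≈xy-xz B C D)) ⟩
        A * (C - D) - B * (C - D)                          ≡⟨ sym ([y-z]x≈yx-zx (C - D) A B) ⟩
        (A - B) * (C - D)                                  ≡⟨ sym (cong₂ _*_ (ℤ-difference a b) (ℤ-difference c d)) ⟩
        ⟦ a , b ⟧ℤ * ⟦ c , d ⟧ℤ                              ∎ }
    ; -‿homo = λ { (a , b) → begin
        ⟦ b , a ⟧ℤ                  ≡⟨ ℤ-difference b a ⟩
        fromℕ b - fromℕ a           ≡⟨ sym (⁻¹-anti-homo‿- (fromℕ a) (fromℕ b)) ⟩
        - (fromℕ a - fromℕ b)       ≡⟨ cong -_ (sym (ℤ-difference a b)) ⟩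
        - ⟦ a , b ⟧ℤ                ∎ }
    ; 0-homo = refl
    ; 1-homo = refl
    }

  _≟ℤ_ : ∀ p q → Maybe (⟦ p ⟧ℤ ≡ ⟦ q ⟧ℤ)
  (a , b) ≟ℤ (c , d) with a ℕ.+ d ℕ.≟ c ℕ.+ b
  ... | yes eq = just (ℤ-cong a b c d eq)
  ... | no _ = nothing

  open import Algebra.Solver.Ring ℤ (fromCommutativeRing commutativeRing) homomorphism _≟ℤ_ public
    using (solve; prove; _:=_; Polynomial; con; var; _:+_; _:*_; _:-_; :-_)

  modulo : ∀ {L R u v w} → L ≡ R + (u - v) * w → u ≡ v → L ≡ R
  modulo {L} {R} {u} {w = w} eq refl = begin
    L                   ≡⟨ eq ⟩
    R + (u - u) * w     ≡⟨ cong (λ t → R + t * w) (-‿inverseʳ u) ⟩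
    R + 0# * w          ≡⟨ cong (R +_) (zeroˡ w) ⟩
    R + 0#              ≡⟨ +-identityʳ R ⟩
    R                   ∎

  modulo₂ : ∀ {L R u v w u′ v′ w′} → L ≡ R + (u - v) * w + (u′ - v′) * w′ → u ≡ v → u′ ≡ v′ → L ≡ R
  modulo₂ eq u≡v u′≡v′ = modulo (modulo eq u′≡v′) u≡v

-- coordinate k of a point of PG(5,q) is the entry (row k , col k) of its matrix M
row col : Fin 6 → Fin 3
row zero = zero
row (suc zero) = zero
row (suc (suc zero)) = zero
row (suc (suc (suc zero))) = suc zero
row (suc (suc (suc (suc zero)))) = suc zero
row (suc (suc (suc (suc (suc zero))))) = suc (suc zero)
col zero = zero
col (suc zero) = suc zero
col (suc (suc zero)) = suc (suc zero)
col (suc (suc (suc zero))) = suc zero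
col (suc (suc (suc (suc zero)))) = suc (suc zero)
col (suc (suc (suc (suc (suc zero))))) = suc (suc zero)

by-coordinate : {P : Fin 3 → Set} → P zero → P (suc zero) → P (suc (suc zero)) → ∀ i → P i
by-coordinate p₀ p₁ p₂ zero = p₀
by-coordinate p₀ p₁ p₂ (suc zero) = p₁
by-coordinate p₀ p₁ p₂ (suc (suc zero)) = p₂

by-entry : {P : Fin 6 → Set} → P zero → P (suc zero) → P (suc (suc zero)) → P (suc (suc (suc zero))) →
          P (suc (suc (suc (suc zero)))) → P (suc (suc (suc (suc (suc zero))))) → ∀ k → P k
by-entry p₀ p₁ p₂ p₃ p₄ p₅ zero = p₀
by-entry p₀ p₁ p₂ p₃ p₄ p₅ (suc zero) = p₁
by-entry p₀ p₁ p₂ p₃ p₄ p₅ (suc (suc zero)) = p₂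
by-entry p₀ p₁ p₂ p₃ p₄ p₅ (suc (suc (suc zero))) = p₃
by-entry p₀ p₁ p₂ p₃ p₄ p₅ (suc (suc (suc (suc zero)))) = p₄
by-entry p₀ p₁ p₂ p₃ p₄ p₅ (suc (suc (suc (suc (suc zero))))) = p₅

-- Coordinate formulas, written once over an arbitrary raw ring: they are
-- used for field elements and for formal polynomials alike, so that
-- identities between them can be handed to the ring solver.
module PlaneFormulas {c ℓ} (R : RawRing c ℓ) where
  open RawRing R

  infixl 6 _-_
  _-_ : Op₂ Carrier
  x - y = x + - y

  vec3 : Carrier → Carrier → Carrier → Fin 3 → Carrier
  vec3 a b c zero = a
  vec3 a b c (suc zero) = b
  vec3 a b c (suc (suc zero)) = c

  pair : (Fin 3 → Carrier) → (Fin 3 → Carrier) → Fin 3 → Fin 3 → Carrier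
  pair x u r s = x r * u s - x s * u r

  cross : (Fin 3 → Carrier) → (Fin 3 → Carrier) → Fin 3 → Carrier
  cross x u zero = pair x u (suc zero) (suc (suc zero))
  cross x u (suc zero) = pair x u (suc (suc zero)) zero
  cross x u (suc (suc zero)) = pair x u zero (suc zero)

  dot : (Fin 3 → Carrier) → (Fin 3 → Carrier) → Carrier
  dot a z = a zero * z zero + a (suc zero) * z (suc zero) + a (suc (suc zero)) * z (suc (suc zero))

  -- entry (r , s) of l xxᵀ + x eᵀ + e xᵀ, from xᵣ, xₛ, eᵣ, eₛ
  hypEntry : Carrier → Carrier → Carrier → Carrier → Carrier → Carrier
  hypEntry l xr xs er es = l * (xr * xs) + (xr * es + er * xs)

  hypForm : Carrier → (Fin 3 → Carrier) → (Fin 3 → Carrier) → Fin 3 → Fin 3 → Carrier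
  hypForm l x e r s = hypEntry l (x r) (x s) (e r) (e s)

  -- entry (r , s) of α xxᵀ + β (x dᵀ + d xᵀ) + γ ddᵀ
  pairEntry : Carrier → Carrier → Carrier → Carrier → Carrier → Carrier → Carrier → Carrier
  pairEntry α β γ xr xs dr ds = α * (xr * xs) + β * (xr * ds + dr * xs) + γ * (dr * ds)

  pairForm : Carrier → Carrier → Carrier → (Fin 3 → Carrier) → (Fin 3 → Carrier) → Fin 3 → Fin 3 → Carrier
  pairForm α β γ x d r s = pairEntry α β γ (x r) (x s) (d r) (d s)

  symDet : Carrier → Carrier → Carrier → Carrier → Carrier → Carrier → Carrier
  symDet y₀ y₁ y₂ y₃ y₄ y₅ = y₀ * (y₃ * y₅ - y₄ * y₄) - y₁ * (y₁ * y₅ - y₄ * y₂) + y₂ * (y₁ * y₄ - y₃ * y₂)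

  -- Explicit data c, l, x, e with c·M_y = l xxᵀ + x eᵀ + e xᵀ for a symmetric
  -- matrix M_y of determinant 0 whose principal minor on rows 0, 1 is
  -- y₀y₃ - y₁² = -s² ≢ 0; one set of data for y₀ ≢ 0, one for y₀ = 0.
  scaleA : (Fin 6 → Carrier) → Carrier → Carrier
  scaleA y s = y (# 0) * y (# 0) * (s * s)

  pointA tangentA : (Fin 6 → Carrier) → Carrier → Fin 3 → Carrier
  pointA y s = vec3 (y (# 0) * s) ((y (# 1) + s) * s) ((y (# 1) + s) * y (# 2) - y (# 0) * y (# 4))
  tangentA y s = vec3 0# (- (s * s * y (# 0))) (y (# 0) * (y (# 0) * y (# 4) - y (# 1) * y (# 2)))

  scaleB : (Fin 6 → Carrier) → Carrier
  scaleB y = y (# 1) * y (# 1)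

  pointB tangentB : (Fin 6 → Carrier) → Fin 3 → Carrier
  pointB y = vec3 0# (y (# 1)) (y (# 2))
  tangentB y = vec3 (y (# 1) * y (# 1)) 0# (y (# 1) * y (# 4) - y (# 3) * y (# 2))

-- The development over a fixed field F.
module Proof (F : FiniteField) where
  open FF F
  open IntegerCoefficientSolver isCommutativeRing
    using (commutativeRing; solve; prove; _:=_; Polynomial; con; var; _:+_; _:*_; _:-_; :-_; modulo; modulo₂)
  open CommutativeRing commutativeRing using (*-comm; zeroˡ; zeroʳ; ring)
  open import Algebra.Properties.Ring ring using (-‿involutive; -0#≈0#)
  open ≡-Reasoning

  fieldRing : RawRing 0ℓ 0ℓ
  fieldRing = record { Carrier = Carrier ; _≈_ = _≡_ ; _+_ = _+_ ; _*_ = _*_ ; -_ = -_ ; 0# = 0# ; 1# = 1# }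

  polynomials : ℕ → RawRing 0ℓ 0ℓ
  polynomials n = record { Carrier = Polynomial n ; _≈_ = _≡_ ; _+_ = _:+_ ; _*_ = _:*_ ; -_ = :-_
                         ; 0# = con (0 , 0) ; 1# = con (1 , 0) }

  open PlaneFormulas fieldRing
    using (vec3; pair; cross; dot; hypForm; pairEntry; pairForm; scaleA; pointA; tangentA; scaleB; pointB; tangentB)
  module Formal {n} = PlaneFormulas (polynomials n)

  𝟘 𝟙 : ∀ {n} → Polynomial n
  𝟘 = con (0 , 0)
  𝟙 = con (1 , 0)

  X₀ : ∀ {n} → Fin 3 → Polynomial (3 ℕ.+ n)
  X₀ = Formal.vec3 (var (# 0)) (var (# 1)) (var (# 2))
  X₁ : ∀ {n} → Fin 3 → Polynomial (6 ℕ.+ n)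
  X₁ = Formal.vec3 (var (# 3)) (var (# 4)) (var (# 5))
  X₂ : ∀ {n} → Fin 3 → Polynomial (9 ℕ.+ n)
  X₂ = Formal.vec3 (var (# 6)) (var (# 7)) (var (# 8))

  infixr 5 _∷ᵥ_
  _∷ᵥ_ : ∀ {n} → Vector 3 → Vec Carrier n → Vec Carrier (3 ℕ.+ n)
  x ∷ᵥ ρ = x zero ∷ x (suc zero) ∷ x (suc (suc zero)) ∷ ρ

  inv : ∀ u → NonZero u → Carrier
  inv u u≢0 = proj₁ (inverse u u≢0)

  inv-right : ∀ u (u≢0 : NonZero u) → u * inv u u≢0 ≡ 1#
  inv-right u u≢0 = proj₂ (inverse u u≢0)

  integral : ∀ u v → u * v ≡ 0# → u ≡ 0# ⊎ v ≡ 0#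
  integral u v uv≡0 with u ≟ 0#
  ... | yes u≡0 = inj₁ u≡0
  ... | no u≢0 = inj₂ (begin
    v                        ≡⟨ modulo (solve 3 (λ u w v → v := w :* (u :* v) :+ (u :* w :- 𝟙) :* (:- v)) refl u w v) (inv-right u u≢0) ⟩
    w * (u * v)              ≡⟨ cong (w *_) uv≡0 ⟩
    w * 0#                   ≡⟨ zeroʳ w ⟩
    0#                       ∎)
    where w : Carrier
          w = inv u u≢0

  nonzero-* : ∀ {u v} → NonZero u → NonZero v → NonZero (u * v)
  nonzero-* {u} {v} u≢0 v≢0 uv≡0 = [ u≢0 , v≢0 ] (integral u v uv≡0)

  square-zero : ∀ u → u * u ≡ 0# → u ≡ 0#
  square-zero u uu≡0 = [ (λ e → e) , (λ e → e) ] (integral u u uu≡0)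

  cancel : ∀ {c u} → NonZero c → c * u ≡ 0# → u ≡ 0#
  cancel {c} {u} c≢0 cu≡0 = [ (λ c≡0 → ⊥-elim (c≢0 c≡0)) , (λ e → e) ] (integral c u cu≡0)

  neg-zero : ∀ u → - u ≡ 0# → u ≡ 0#
  neg-zero u h = trans (sym (-‿involutive u)) (trans (cong -_ h) -0#≈0#)

  nonzero-index : (v : Vector 3) → NonZeroVec v → Σ (Fin 3) λ j → NonZero (v j)
  nonzero-index v v≢0 with v zero ≟ 0# | v (suc zero) ≟ 0# | v (suc (suc zero)) ≟ 0#
  ... | no n | _ | _ = zero , n
  ... | yes _ | no n | _ = suc zero , n
  ... | yes _ | yes _ | no n = suc (suc zero) , n
  ... | yes z₀ | yes z₁ | yes z₂ = ⊥-elim (v≢0 (by-coordinate z₀ z₁ z₂))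

  dot-congˡ : ∀ {a b : Vector 3} z → a ≐ b → dot a z ≡ dot b z
  dot-congˡ z a≐b = cong₂ _+_ (cong₂ _+_ (cong (_* z zero) (a≐b zero)) (cong (_* z (suc zero)) (a≐b (suc zero))))
                              (cong (_* z (suc (suc zero))) (a≐b (suc (suc zero))))

  unit : Fin 3 → Vector 3
  unit zero = vec3 1# 0# 0#
  unit (suc zero) = vec3 0# 1# 0#
  unit (suc (suc zero)) = vec3 0# 0# 1#

  unit-dot : ∀ x j → dot x (unit j) ≡ x j
  unit-dot x = by-coordinate (prove ρ (Formal.dot X₀ (Formal.vec3 𝟙 𝟘 𝟘)) (X₀ zero) refl)
                            (prove ρ (Formal.dot X₀ (Formal.vec3 𝟘 𝟙 𝟘)) (X₀ (suc zero)) refl)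
                            (prove ρ (Formal.dot X₀ (Formal.vec3 𝟘 𝟘 𝟙)) (X₀ (suc (suc zero))) refl)
    where ρ : Vec Carrier 3
          ρ = x ∷ᵥ []

  dual : ∀ x → NonZeroVec x → Σ (Vector 3) λ w → NonZero (dot x w)
  dual x x≢0 = unit j , λ x·w≡0 → xj≢0 (trans (sym (unit-dot x j)) x·w≡0)
    where j : Fin 3
          j = proj₁ (nonzero-index x x≢0)
          xj≢0 : NonZero (x j)
          xj≢0 = proj₂ (nonzero-index x x≢0)

  -- Every line through the point x has coordinates x × d for some d:
  -- take d = (a × w) / (x · w), then x × d = a by the BAC-CAB rule.
  line-through : ∀ a x → NonZeroVec x → dot a x ≡ 0# → Σ (Vector 3) λ d → a ≐ cross x d
  line-through a x x≢0 a·x≡0 = d , λ i → sym (x×d≡a i)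
    where
      w : Vector 3
      w = proj₁ (dual x x≢0)
      c : Carrier
      c = inv (dot x w) (proj₂ (dual x x≢0))
      d : Vector 3
      d r = c * cross a w r
      ρ : Vec Carrier 10
      ρ = x ∷ᵥ a ∷ᵥ w ∷ᵥ c ∷ []
      𝕔 : Polynomial 10
      𝕔 = var (# 9)
      𝕕 : Fin 3 → Polynomial 10
      𝕕 r = 𝕔 :* Formal.cross X₁ X₂ r
      -- x × (c (a × w)) = a + (a·x) (-c w) + (c (x·w) - 1) a
      bacCab : Fin 3 → Polynomial 10
      bacCab i = (X₁ i :+ (Formal.dot X₁ X₀ :- 𝟘) :* (:- (𝕔 :* X₂ i))) :+ (Formal.dot X₀ X₂ :* 𝕔 :- 𝟙) :* X₁ i
      x×d≡a : ∀ i → cross x d i ≡ a i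
      x×d≡a = by-coordinate
        (modulo₂ (prove ρ (Formal.cross X₀ 𝕕 zero) (bacCab zero) refl) a·x≡0 (inv-right _ _))
        (modulo₂ (prove ρ (Formal.cross X₀ 𝕕 (suc zero)) (bacCab (suc zero)) refl) a·x≡0 (inv-right _ _))
        (modulo₂ (prove ρ (Formal.cross X₀ 𝕕 (suc (suc zero))) (bacCab (suc (suc zero))) refl) a·x≡0 (inv-right _ _))

  -- By
  -- Cramer's rule, for any v,
  --   ((x×d)·v) z = ((z×d)·v) x + ((x×z)·v) d + ((x×d)·z) v,
  -- and (x×d)·z = 0; choose v with (x×d)·v ≢ 0.
  points-of-line : ∀ a x d z → a ≐ cross x d → NonZeroVec a → dot a z ≡ 0# →
                 Σ Carrier λ s → Σ Carrier λ t → ∀ r → z r ≡ s * x r + t * d r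
  points-of-line a x d z a≐x×d a≢0 a·z≡0 = c * dot (cross z d) v , c * dot (cross x z) v , decompose
    where
      v : Vector 3
      v = proj₁ (dual a a≢0)
      c : Carrier
      c = inv (dot a v) (proj₂ (dual a a≢0))
      normal : dot (cross x d) v * c ≡ 1#
      normal = trans (cong (_* c) (sym (dot-congˡ v a≐x×d))) (inv-right _ _)
      incident : dot (cross x d) z ≡ 0#
      incident = trans (sym (dot-congˡ z a≐x×d)) a·z≡0
      ρ : Vec Carrier 13
      ρ = x ∷ᵥ d ∷ᵥ z ∷ᵥ v ∷ᵥ c ∷ []
      𝕧 : Fin 3 → Polynomial 13
      𝕧 = Formal.vec3 (var (# 9)) (var (# 10)) (var (# 11))
      𝕔 : Polynomial 13
      𝕔 = var (# 12)
      cramer : Fin 3 → Polynomial 13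
      cramer i = ((𝕔 :* Formal.dot (Formal.cross X₂ X₁) 𝕧) :* X₀ i :+ (𝕔 :* Formal.dot (Formal.cross X₀ X₂) 𝕧) :* X₁ i
                  :+ (Formal.dot (Formal.cross X₀ X₁) X₂ :- 𝟘) :* (𝕔 :* 𝕧 i))
                 :+ (Formal.dot (Formal.cross X₀ X₁) 𝕧 :* 𝕔 :- 𝟙) :* (:- X₂ i)
      decompose : ∀ r → z r ≡ (c * dot (cross z d) v) * x r + (c * dot (cross x z) v) * d r
      decompose = by-coordinate
        (modulo₂ (prove ρ (X₂ zero) (cramer zero) refl) incident normal)
        (modulo₂ (prove ρ (X₂ (suc zero)) (cramer (suc zero)) refl) incident normal)
        (modulo₂ (prove ρ (X₂ (suc (suc zero))) (cramer (suc (suc zero))) refl) incident normal)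

  Proportional : Vector 3 → Vector 3 → Set
  Proportional x u = ∀ r s → pair x u r s ≡ 0#

  cross-vanishes : ∀ x u → Proportional x u → ∀ i → cross x u i ≡ 0#
  cross-vanishes x u h = by-coordinate (h _ _) (h _ _) (h _ _)

  multiple : ∀ x u → NonZeroVec x → Proportional x u → Σ Carrier λ t → ∀ r → u r ≡ t * x r
  multiple x u x≢0 h = u j * w , λ r →
      modulo₂ (solve 5 (λ uᵣ uⱼ xᵣ xⱼ w →
                 uᵣ := (uⱼ :* w) :* xᵣ :+ (xⱼ :* uᵣ :- xᵣ :* uⱼ :- 𝟘) :* w :+ (xⱼ :* w :- 𝟙) :* (:- uᵣ))
               refl (u r) (u j) (x r) (x j) w)
              (h j r) (inv-right (x j) xj≢0)
    where
      j : Fin 3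
      j = proj₁ (nonzero-index x x≢0)
      xj≢0 : NonZero (x j)
      xj≢0 = proj₂ (nonzero-index x x≢0)
      w : Carrier
      w = inv (x j) xj≢0

  zero-proportionalʳ : ∀ x u → (∀ r → u r ≡ 0#) → Proportional x u
  zero-proportionalʳ x u u≡0 r s = trans (cong₂ (λ p q → x r * p - x s * q) (u≡0 s) (u≡0 r))
    (solve 2 (λ a b → a :* 𝟘 :- b :* 𝟘 := 𝟘) refl (x r) (x s))

  zero-proportionalˡ : ∀ x u → (∀ r → x r ≡ 0#) → Proportional x u
  zero-proportionalˡ x u x≡0 r s = trans (cong₂ (λ p q → p * u s - q * u r) (x≡0 r) (x≡0 s))
    (solve 2 (λ a b → 𝟘 :* a :- 𝟘 :* b := 𝟘) refl (u s) (u r))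

  -- if u uᵀ = c x xᵀ then x and u are proportional: (xᵣuₛ - xₛuᵣ)² expands to 0
  outer-proportional : ∀ x u c → (∀ r s → u r * u s ≡ c * (x r * x s)) → Proportional x u
  outer-proportional x u c h r s = square-zero (pair x u r s)
    (modulo (modulo (modulo (solve 5 (λ xᵣ xₛ uᵣ uₛ c →
        (xᵣ :* uₛ :- xₛ :* uᵣ) :* (xᵣ :* uₛ :- xₛ :* uᵣ)
          := 𝟘 :+ (uₛ :* uₛ :- c :* (xₛ :* xₛ)) :* (xᵣ :* xᵣ) :+ (uᵣ :* uₛ :- c :* (xᵣ :* xₛ)) :* (:- (xᵣ :* xₛ) :- xᵣ :* xₛ)
             :+ (uᵣ :* uᵣ :- c :* (xᵣ :* xᵣ)) :* (xₛ :* xₛ))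
        refl (x r) (x s) (u r) (u s) c) (h r r)) (h r s)) (h s s))

  -- If c zzᵀ = κ xxᵀ + β (l xxᵀ + x eᵀ + e xᵀ) with c ≢ 0, then z is
  -- proportional to x: evaluate both quadratic forms at a vector w with
  -- wᵣ = xₛ, wₛ = -xᵣ (zero elsewhere), which is orthogonal to x.
  tangent-proportional : ∀ c κ β l x e z → NonZero c →
    (∀ r s → c * (z r * z s) ≡ κ * (x r * x s) + β * hypForm l x e r s) → Proportional x z
  tangent-proportional c κ β l x e z c≢0 h r s = square-zero (pair x z r s) (cancel c≢0
    (modulo (modulo (modulo (solve 10 (λ c κ β l xᵣ xₛ eᵣ eₛ zᵣ zₛ →
        let Q : Polynomial 10 → Polynomial 10 → Polynomial 10 → Polynomial 10 → Polynomial 10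
            Q xₚ x_q eₚ e_q = κ :* (xₚ :* x_q) :+ β :* Formal.hypEntry l xₚ x_q eₚ e_q in
        c :* ((xᵣ :* zₛ :- xₛ :* zᵣ) :* (xᵣ :* zₛ :- xₛ :* zᵣ))
          := 𝟘 :+ (c :* (zₛ :* zₛ) :- Q xₛ xₛ eₛ eₛ) :* (xᵣ :* xᵣ)
             :+ (c :* (zᵣ :* zₛ) :- Q xᵣ xₛ eᵣ eₛ) :* (:- (xᵣ :* xₛ) :- xᵣ :* xₛ)
             :+ (c :* (zᵣ :* zᵣ) :- Q xᵣ xᵣ eᵣ eᵣ) :* (xₛ :* xₛ))
        refl c κ β l (x r) (x s) (e r) (e s) (z r) (z s)) (h r r)) (h r s)) (h s s)))

  Symmetric : Mat 3 → Set
  Symmetric B = ∀ r s → B r s ≡ B s r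

  M-symmetric : ∀ y → Symmetric (M y)
  M-symmetric y zero zero = refl
  M-symmetric y zero (suc zero) = refl
  M-symmetric y zero (suc (suc zero)) = refl
  M-symmetric y (suc zero) zero = refl
  M-symmetric y (suc zero) (suc zero) = refl
  M-symmetric y (suc zero) (suc (suc zero)) = refl
  M-symmetric y (suc (suc zero)) zero = refl
  M-symmetric y (suc (suc zero)) (suc zero) = refl
  M-symmetric y (suc (suc zero)) (suc (suc zero)) = refl

  M-entry : ∀ y k → M y (row k) (col k) ≡ y k
  M-entry y = by-entry refl refl refl refl refl refl

  ν-entry : ∀ z k → ν z k ≡ z (row k) * z (col k)
  ν-entry z = by-entry refl refl refl refl refl refl

  outer-symmetric : ∀ (z : Vector 3) → Symmetric (λ r s → z r * z s)
  outer-symmetric z r s = *-comm (z r) (z s)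

  hypForm-symmetric : ∀ l x e → Symmetric (hypForm l x e)
  hypForm-symmetric l x e r s =
    solve 5 (λ l xᵣ xₛ eᵣ eₛ → Formal.hypEntry l xᵣ xₛ eᵣ eₛ := Formal.hypEntry l xₛ xᵣ eₛ eᵣ) refl l (x r) (x s) (e r) (e s)

  symmetric-ext : ∀ {B C : Mat 3} → Symmetric B → Symmetric C →
                  (∀ k → B (row k) (col k) ≡ C (row k) (col k)) → ∀ r s → B r s ≡ C r s
  symmetric-ext symB symC h zero zero = h zero
  symmetric-ext symB symC h zero (suc zero) = h (suc zero)
  symmetric-ext symB symC h zero (suc (suc zero)) = h (suc (suc zero))
  symmetric-ext symB symC h (suc zero) zero = trans (symB _ _) (trans (h (suc zero)) (symC _ _))
  symmetric-ext symB symC h (suc zero) (suc zero) = h (suc (suc (suc zero)))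
  symmetric-ext symB symC h (suc zero) (suc (suc zero)) = h (suc (suc (suc (suc zero))))
  symmetric-ext symB symC h (suc (suc zero)) zero = trans (symB _ _) (trans (h (suc (suc zero))) (symC _ _))
  symmetric-ext symB symC h (suc (suc zero)) (suc zero) = trans (symB _ _) (trans (h (suc (suc (suc (suc zero))))) (symC _ _))
  symmetric-ext symB symC h (suc (suc zero)) (suc (suc zero)) = h (suc (suc (suc (suc (suc zero)))))

  det2-cong : ∀ {A B : Mat 3} i j → (∀ r s → A r s ≡ B r s) → det2 (minor i j A) ≡ det2 (minor i j B)
  det2-cong i j A≡B = cong₂ _-_ (cong₂ _*_ (A≡B _ _) (A≡B _ _)) (cong₂ _*_ (A≡B _ _) (A≡B _ _))

  det2-scale : ∀ c (A : Mat 3) i j → det2 (minor i j (λ r s → c * A r s)) ≡ (c * c) * det2 (minor i j A)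
  det2-scale c A i j = solve 5 (λ c a b d e → (c :* a) :* (c :* b) :- (c :* d) :* (c :* e) := (c :* c) :* (a :* b :- d :* e))
    refl c (A (punchIn i zero) (punchIn j zero)) (A (punchIn i (suc zero)) (punchIn j (suc zero)))
           (A (punchIn i zero) (punchIn j (suc zero))) (A (punchIn i (suc zero)) (punchIn j zero))

  coPair : Fin 3 → Vector 3 → Vector 3 → Carrier
  coPair i x e = pair x e (punchIn i zero) (punchIn i (suc zero))

  minor-hypForm : ∀ l x e i j → det2 (minor i j (hypForm l x e)) ≡ - (coPair i x e * coPair j x e)
  minor-hypForm l x e i j = solve 9 (λ l a₀ a₁ b₀ b₁ e₀ e₁ f₀ f₁ →
      Formal.hypEntry l a₀ b₀ e₀ f₀ :* Formal.hypEntry l a₁ b₁ e₁ f₁ :- Formal.hypEntry l a₀ b₁ e₀ f₁ :* Formal.hypEntry l a₁ b₀ e₁ f₀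
        := :- ((a₀ :* e₁ :- a₁ :* e₀) :* (b₀ :* f₁ :- b₁ :* f₀)))
    refl l (x (punchIn i zero)) (x (punchIn i (suc zero))) (x (punchIn j zero)) (x (punchIn j (suc zero)))
           (e (punchIn i zero)) (e (punchIn i (suc zero))) (e (punchIn j zero)) (e (punchIn j (suc zero)))

  principal-minors : ∀ (A : Mat 3) (f : Fin 3 → Carrier) → (∀ i j → det2 (minor i j A) ≡ - (f i * f j)) →
                     (∀ i → det2 (minor i i A) ≡ 0#) → ∀ i j → det2 (minor i j A) ≡ 0#
  principal-minors A f factor principal≡0 i j = begin
    det2 (minor i j A)   ≡⟨ factor i j ⟩
    - (f i * f j)        ≡⟨ cong (λ t → - (t * f j)) (fᵢ≡0 i) ⟩
    - (0# * f j)         ≡⟨ cong -_ (zeroˡ (f j)) ⟩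
    - 0#                 ≡⟨ -0#≈0# ⟩
    0#                   ∎
    where fᵢ≡0 : ∀ i → f i ≡ 0#
          fᵢ≡0 i = square-zero (f i) (neg-zero _ (trans (sym (factor i i)) (principal≡0 i)))

  absorb : ∀ c s t α β γ xᵣ xₛ dᵣ dₛ →
    c * ((s * xᵣ + t * dᵣ) * (s * xₛ + t * dₛ)) + pairEntry α β γ xᵣ xₛ dᵣ dₛ
      ≡ pairEntry (c * (s * s) + α) (c * (s * t) + β) (c * (t * t) + γ) xᵣ xₛ dᵣ dₛ
  absorb = solve 10 (λ c s t α β γ xᵣ xₛ dᵣ dₛ →
    c :* ((s :* xᵣ :+ t :* dᵣ) :* (s :* xₛ :+ t :* dₛ)) :+ Formal.pairEntry α β γ xᵣ xₛ dᵣ dₛ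
      := Formal.pairEntry (c :* (s :* s) :+ α) (c :* (s :* t) :+ β) (c :* (t :* t) :+ γ) xᵣ xₛ dᵣ dₛ) refl

  PairShaped : Vector 3 → Vector 3 → Vector 6 → Set
  PairShaped x d w = Σ Carrier λ α → Σ Carrier λ β → Σ Carrier λ γ → ∀ k → w k ≡ pairForm α β γ x d (row k) (col k)

  span-shape : ∀ a x d → a ≐ cross x d → NonZeroVec a → ∀ lst → All (λ q → OnConic a (proj₂ q)) lst →
               PairShaped x d (sumV lst)
  span-shape a x d a≐x×d a≢0 [] [] = 0# , 0# , 0# , λ k →
    solve 4 (λ xᵣ xₛ dᵣ dₛ → 𝟘 := Formal.pairEntry 𝟘 𝟘 𝟘 xᵣ xₛ dᵣ dₛ) refl (x (row k)) (x (col k)) (d (row k)) (d (col k))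
  span-shape a x d a≐x×d a≢0 ((c , w) ∷ lst) ((z , _ , z∈a , w≐νz) ∷ onConic) =
    c * (s * s) + α , c * (s * t) + β , c * (t * t) + γ , λ k → begin
      c * w k + sumV lst k
        ≡⟨ cong₂ (λ u v → c * u + v) (trans (w≐νz k) (trans (ν-entry z k) (cong₂ _*_ (z≡ (row k)) (z≡ (col k))))) (shape k) ⟩
      c * ((s * x (row k) + t * d (row k)) * (s * x (col k) + t * d (col k))) + pairForm α β γ x d (row k) (col k)
        ≡⟨ absorb c s t α β γ (x (row k)) (x (col k)) (d (row k)) (d (col k)) ⟩
      pairForm (c * (s * s) + α) (c * (s * t) + β) (c * (t * t) + γ) x d (row k) (col k) ∎
    where
      rest : PairShaped x d (sumV lst)
      rest = span-shape a x d a≐x×d a≢0 lst onConic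
      α β γ : Carrier
      α = proj₁ rest
      β = proj₁ (proj₂ rest)
      γ = proj₁ (proj₂ (proj₂ rest))
      shape : ∀ k → sumV lst k ≡ pairForm α β γ x d (row k) (col k)
      shape = proj₂ (proj₂ (proj₂ rest))
      combination : Σ Carrier λ s → Σ Carrier λ t → ∀ r → z r ≡ s * x r + t * d r
      combination = points-of-line a x d z a≐x×d a≢0 z∈a
      s t : Carrier
      s = proj₁ combination
      t = proj₁ (proj₂ combination)
      z≡ : ∀ r → z r ≡ s * x r + t * d r
      z≡ = proj₂ (proj₂ combination)

  combination-incident : ∀ β γ x d → dot (cross x d) (λ r → β * x r + γ * d r) ≡ 0#
  combination-incident β γ x d =
    prove (x ∷ᵥ d ∷ᵥ β ∷ γ ∷ []) (Formal.dot (Formal.cross X₀ X₁) (λ r → var (# 6) :* X₀ r :+ var (# 7) :* X₁ r)) 𝟘 refl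

  combination-pair : ∀ β γ x d r s → γ * pair x d r s ≡ pair x (λ r → β * x r + γ * d r) r s
  combination-pair β γ x d r s = solve 6 (λ β γ xᵣ xₛ dᵣ dₛ →
      γ :* (xᵣ :* dₛ :- xₛ :* dᵣ) := xᵣ :* (β :* xₛ :+ γ :* dₛ) :- xₛ :* (β :* xᵣ :+ γ :* dᵣ))
    refl β γ (x r) (x s) (d r) (d s)

  combination-outer : ∀ α β γ xᵣ xₛ dᵣ dₛ →
    (β * xᵣ + γ * dᵣ) * (β * xₛ + γ * dₛ) ≡ (β * β - γ * α) * (xᵣ * xₛ) + γ * pairEntry α β γ xᵣ xₛ dᵣ dₛ
  combination-outer = solve 7 (λ α β γ xᵣ xₛ dᵣ dₛ →
    (β :* xᵣ :+ γ :* dᵣ) :* (β :* xₛ :+ γ :* dₛ) := (β :* β :- γ :* α) :* (xᵣ :* xₛ) :+ γ :* Formal.pairEntry α β γ xᵣ xₛ dᵣ dₛ) refl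

  -- On a tangent line through p = ν x the coefficient γ vanishes: otherwise
  -- z = β x + γ d is a point of the line, not proportional to x, whose image
  -- ν z = (β² - γα) p + γ y lies on the tangent line as well.
  tangent-coefficient : ∀ a x d y p α β γ → NonZeroVec a → a ≐ cross x d → p ≐ ν x →
    (∀ k → y k ≡ pairForm α β γ x d (row k) (col k)) →
    (∀ w → OnConic a w → OnLineThrough p y w → SamePoint w p) → γ ≡ 0#
  tangent-coefficient a x d y p α β γ a≢0 a≐x×d p≐νx y≡ tangent with γ ≟ 0#
  ... | yes γ≡0 = γ≡0
  ... | no γ≢0 = ⊥-elim (not-proportional (outer-proportional x z cc zzᵀ≡cxxᵀ))
    where
      z : Vector 3
      z r = β * x r + γ * d r

      not-proportional : Proportional x z → ⊥
      not-proportional h = nonzero-* γ≢0 (proj₂ (nonzero-index a a≢0)) (begin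
        γ * a j           ≡⟨ cong (γ *_) (a≐x×d j) ⟩
        γ * cross x d j   ≡⟨ by-coordinate {P = λ i → γ * cross x d i ≡ cross x z i}
                               (combination-pair β γ x d _ _) (combination-pair β γ x d _ _) (combination-pair β γ x d _ _) j ⟩
        cross x z j       ≡⟨ cross-vanishes x z h j ⟩
        0#                ∎)
        where j : Fin 3
              j = proj₁ (nonzero-index a a≢0)

      νz-on-line : ∀ k → ν z k ≡ (β * β - γ * α) * p k + γ * y k
      νz-on-line k = begin
        ν z k                    ≡⟨ ν-entry z k ⟩
        z (row k) * z (col k)    ≡⟨ combination-outer α β γ (x (row k)) (x (col k)) (d (row k)) (d (col k)) ⟩
        (β * β - γ * α) * (x (row k) * x (col k)) + γ * pairForm α β γ x d (row k) (col k)
          ≡⟨ sym (cong₂ (λ u v → (β * β - γ * α) * u + γ * v) (trans (p≐νx k) (ν-entry x k)) (y≡ k)) ⟩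
        (β * β - γ * α) * p k + γ * y k ∎

      sameAsP : SamePoint (ν z) p
      sameAsP = tangent (ν z) (z , (λ z≡0 → not-proportional (zero-proportionalʳ x z z≡0)) ,
                               trans (dot-congˡ z a≐x×d) (combination-incident β γ x d) , λ _ → refl)
                        (β * β - γ * α , γ , νz-on-line)
      cc : Carrier
      cc = proj₁ sameAsP

      zzᵀ≡cxxᵀ : ∀ r s → z r * z s ≡ cc * (x r * x s)
      zzᵀ≡cxxᵀ = symmetric-ext (outer-symmetric z) (λ r s → cong (cc *_) (outer-symmetric x r s)) λ k → begin
        z (row k) * z (col k)          ≡⟨ sym (ν-entry z k) ⟩
        ν z k                          ≡⟨ proj₂ sameAsP k ⟩
        cc * p k                       ≡⟨ cong (cc *_) (trans (p≐νx k) (ν-entry x k)) ⟩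
        cc * (x (row k) * x (col k))   ∎

  SquareCriterion : Vector 6 → Set
  SquareCriterion y = det3 (M y) ≡ 0# ×
    IsSquare (- det2 (minor zero zero (M y))) ×
    IsSquare (- det2 (minor (suc zero) (suc zero) (M y))) ×
    IsSquare (- det2 (minor (suc (suc zero)) (suc (suc zero)) (M y))) ×
    (NonZero (det2 (minor zero zero (M y))) ⊎
      NonZero (det2 (minor (suc zero) (suc zero) (M y))) ⊎
      NonZero (det2 (minor (suc (suc zero)) (suc (suc zero)) (M y))))

  -- a non-zero matrix l xxᵀ + x eᵀ + e xᵀ of determinant 0 satisfies the
  -- square criterion: its principal minors are -(coPair)², and if all of
  -- them vanish then so do all minors
  criterion-of-normal-form : ∀ y l x e → det3 (M y) ≡ 0# → (∀ r s → M y r s ≡ hypForm l x e r s) →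
                             (Σ (Fin 3) λ i → Σ (Fin 3) λ j → NonZero (det2 (minor i j (M y)))) → SquareCriterion y
  criterion-of-normal-form y l x e det≡0 My≡ (i , j , minorᵢⱼ≢0) =
    det≡0 , square zero , square (suc zero) , square (suc (suc zero)) , some-principal
    where
      minors : ∀ i j → det2 (minor i j (M y)) ≡ - (coPair i x e * coPair j x e)
      minors i j = trans (det2-cong i j My≡) (minor-hypForm l x e i j)

      square : ∀ i → IsSquare (- det2 (minor i i (M y)))
      square i = coPair i x e , trans (cong -_ (minors i i)) (-‿involutive _)

      some-principal : NonZero (det2 (minor zero zero (M y))) ⊎
                       NonZero (det2 (minor (suc zero) (suc zero) (M y))) ⊎
                       NonZero (det2 (minor (suc (suc zero)) (suc (suc zero)) (M y)))
      some-principal with det2 (minor zero zero (M y)) ≟ 0# | det2 (minor (suc zero) (suc zero) (M y)) ≟ 0#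
                        | det2 (minor (suc (suc zero)) (suc (suc zero)) (M y)) ≟ 0#
      ... | no n | _ | _ = inj₁ n
      ... | yes _ | no n | _ = inj₂ (inj₁ n)
      ... | yes _ | yes _ | no n = inj₂ (inj₂ n)
      ... | yes z₀ | yes z₁ | yes z₂ =
        ⊥-elim (minorᵢⱼ≢0 (principal-minors (M y) (λ i → coPair i x e) minors (by-coordinate z₀ z₁ z₂) i j))

  -- A point of P₂,ₑ is α xxᵀ + x eᵀ + e xᵀ with e = β d, where x × d is the
  -- line of its conic and ν x the point of tangency.
  forward : ∀ y → P2e y → SquareCriterion y
  forward y ((det≡0 , rank2) , a , a≢0 , (lst , onConic , y≐span) , p , (x , x≢0 , x∈a , p≐νx) , tangent) =
    criterion-of-normal-form y α x e det≡0 My≡ rank2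
    where
      d : Vector 3
      d = proj₁ (line-through a x x≢0 x∈a)
      a≐x×d : a ≐ cross x d
      a≐x×d = proj₂ (line-through a x x≢0 x∈a)
      shape : PairShaped x d (sumV lst)
      shape = span-shape a x d a≐x×d a≢0 lst onConic
      α β γ : Carrier
      α = proj₁ shape
      β = proj₁ (proj₂ shape)
      γ = proj₁ (proj₂ (proj₂ shape))

      y≡ : ∀ k → y k ≡ pairForm α β γ x d (row k) (col k)
      y≡ k = trans (y≐span k) (proj₂ (proj₂ (proj₂ shape)) k)

      e : Vector 3
      e r = β * d r

      My≡ : ∀ r s → M y r s ≡ hypForm α x e r s
      My≡ = symmetric-ext (M-symmetric y) (hypForm-symmetric α x e) λ k → begin
        M y (row k) (col k)                    ≡⟨ M-entry y k ⟩
        y k                                    ≡⟨ y≡ k ⟩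
        pairForm α β γ x d (row k) (col k)     ≡⟨ cong (λ g → pairForm α β g x d (row k) (col k))
                                                       (tangent-coefficient a x d y p α β γ a≢0 a≐x×d p≐νx y≡ tangent) ⟩
        pairForm α β 0# x d (row k) (col k)    ≡⟨ solve 6 (λ α β xᵣ xₛ dᵣ dₛ →
                                                    Formal.pairEntry α β 𝟘 xᵣ xₛ dᵣ dₛ := Formal.hypEntry α xᵣ xₛ (β :* dᵣ) (β :* dₛ))
                                                  refl α β (x (row k)) (x (col k)) (d (row k)) (d (col k)) ⟩
        hypForm α x e (row k) (col k)          ∎

  record Representation (A : Mat 3) : Set where
    field
      c l : Carrier
      x e : Vector 3
      c≢0 : NonZero c
      represents : ∀ r s → c * A r s ≡ hypForm l x e r s

  -- by symmetry it suffices to check the six coordinates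
  from-coordinates : ∀ y c l x e → NonZero c → (∀ k → c * y k ≡ hypForm l x e (row k) (col k)) → Representation (M y)
  from-coordinates y c l x e c≢0 h = record
    { c = c ; l = l ; x = x ; e = e ; c≢0 = c≢0
    ; represents = symmetric-ext (λ r s → cong (c *_) (M-symmetric y r s)) (hypForm-symmetric l x e)
                                 (λ k → trans (cong (c *_) (M-entry y k)) (h k)) }

  𝕪 : Fin 6 → Polynomial 7
  𝕪 k = var (inject₁ k)

  𝕤 : Polynomial 7
  𝕤 = var (# 6)

  𝔻 : Polynomial 7
  𝔻 = Formal.symDet (𝕪 (# 0)) (𝕪 (# 1)) (𝕪 (# 2)) (𝕪 (# 3)) (𝕪 (# 4)) (𝕪 (# 5))

  environment : Vector 6 → Carrier → Vec Carrier 7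
  environment y s = y (# 0) ∷ y (# 1) ∷ y (# 2) ∷ y (# 3) ∷ y (# 4) ∷ y (# 5) ∷ s ∷ []

  -- The explicit data of PlaneFormulas represent M_y when det M_y = 0 and
  -- y₀y₃ - y₁² = -s² ≢ 0.  Each coordinate is a ring identity modulo the two
  -- hypotheses, with the cofactors coS and coD.
  representation-A : ∀ y s → det3 (M y) ≡ 0# → - det2 (minor (# 2) (# 2) (M y)) ≡ s * s →
                     NonZero s → NonZero (y (# 0)) → Representation (M y)
  representation-A y s det≡0 minor≡-s² s≢0 y₀≢0 =
    from-coordinates y (scaleA y s) (y (# 0)) (pointA y s) (tangentA y s) (nonzero-* (nonzero-* y₀≢0 y₀≢0) (nonzero-* s≢0 s≢0))
      (by-entry (modulo₂ (prove ρ (lhs (# 0)) (rhs (# 0)) refl) minor≡-s² det≡0)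
                (modulo₂ (prove ρ (lhs (# 1)) (rhs (# 1)) refl) minor≡-s² det≡0)
                (modulo₂ (prove ρ (lhs (# 2)) (rhs (# 2)) refl) minor≡-s² det≡0)
                (modulo₂ (prove ρ (lhs (# 3)) (rhs (# 3)) refl) minor≡-s² det≡0)
                (modulo₂ (prove ρ (lhs (# 4)) (rhs (# 4)) refl) minor≡-s² det≡0)
                (modulo₂ (prove ρ (lhs (# 5)) (rhs (# 5)) refl) minor≡-s² det≡0))
    where
      ρ : Vec Carrier 7
      ρ = environment y s
      coS coD : Fin 6 → Polynomial 7
      coS (suc (suc (suc zero))) = :- (𝕤 :* 𝕤 :* 𝕪 (# 0))
      coS (suc (suc (suc (suc (suc zero))))) = 𝕪 (# 0) :* 𝕪 (# 2) :* 𝕪 (# 2) :- 𝕪 (# 0) :* 𝕪 (# 0) :* 𝕪 (# 5)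
      coS _ = 𝟘
      coD (suc (suc (suc (suc (suc zero))))) = :- (𝕪 (# 0) :* 𝕪 (# 0))
      coD _ = 𝟘
      lhs rhs : Fin 6 → Polynomial 7
      lhs k = Formal.scaleA 𝕪 𝕤 :* 𝕪 k
      rhs k = Formal.hypForm (𝕪 (# 0)) (Formal.pointA 𝕪 𝕤) (Formal.tangentA 𝕪 𝕤) (row k) (col k)
              :+ (:- (𝕪 (# 0) :* 𝕪 (# 3) :- 𝕪 (# 1) :* 𝕪 (# 1)) :- 𝕤 :* 𝕤) :* coS k
              :+ (𝔻 :- 𝟘) :* coD k

  representation-B : ∀ y → det3 (M y) ≡ 0# → y (# 0) ≡ 0# → NonZero (y (# 1)) → Representation (M y)
  representation-B y det≡0 y₀≡0 y₁≢0 =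
    from-coordinates y (scaleB y) (y (# 3)) (pointB y) (tangentB y) (nonzero-* y₁≢0 y₁≢0)
      (by-entry (modulo₂ (prove ρ (lhs (# 0)) (rhs (# 0)) refl) y₀≡0 det≡0)
                (modulo₂ (prove ρ (lhs (# 1)) (rhs (# 1)) refl) y₀≡0 det≡0)
                (modulo₂ (prove ρ (lhs (# 2)) (rhs (# 2)) refl) y₀≡0 det≡0)
                (modulo₂ (prove ρ (lhs (# 3)) (rhs (# 3)) refl) y₀≡0 det≡0)
                (modulo₂ (prove ρ (lhs (# 4)) (rhs (# 4)) refl) y₀≡0 det≡0)
                (modulo₂ (prove ρ (lhs (# 5)) (rhs (# 5)) refl) y₀≡0 det≡0))
    where
      ρ : Vec Carrier 7
      ρ = environment y 0#
      coS coD : Fin 6 → Polynomial 7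
      coS zero = 𝕪 (# 1) :* 𝕪 (# 1)
      coS (suc (suc (suc (suc (suc zero))))) = 𝕪 (# 3) :* 𝕪 (# 5) :- 𝕪 (# 4) :* 𝕪 (# 4)
      coS _ = 𝟘
      coD (suc (suc (suc (suc (suc zero))))) = :- 𝟙
      coD _ = 𝟘
      lhs rhs : Fin 6 → Polynomial 7
      lhs k = Formal.scaleB 𝕪 :* 𝕪 k
      rhs k = Formal.hypForm (𝕪 (# 3)) (Formal.pointB 𝕪) (Formal.tangentB 𝕪) (row k) (col k)
              :+ (𝕪 (# 0) :- 𝟘) :* coS k
              :+ (𝔻 :- 𝟘) :* coD k

  standard-representation : ∀ y s → det3 (M y) ≡ 0# → - det2 (minor (# 2) (# 2) (M y)) ≡ s * s →
                            NonZero (det2 (minor (# 2) (# 2) (M y))) → Representation (M y)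
  standard-representation y s det≡0 minor≡-s² minor≢0 with y (# 0) ≟ 0#
  ... | no y₀≢0 = representation-A y s det≡0 minor≡-s² s≢0 y₀≢0
    where
      s≢0 : NonZero s
      s≢0 s≡0 = minor≢0 (neg-zero _ (trans minor≡-s² (trans (cong (λ t → t * t) s≡0) (zeroˡ 0#))))
  ... | yes y₀≡0 = representation-B y det≡0 y₀≡0 y₁≢0
    where
      y₁≢0 : NonZero (y (# 1))
      y₁≢0 y₁≡0 = minor≢0 (trans (cong₂ (λ u v → u * y (# 3) - v * v) y₀≡0 y₁≡0)
                                 (solve 1 (λ a → 𝟘 :* a :- 𝟘 :* 𝟘 := 𝟘) refl (y (# 3))))

  -- The frame of i lists the rows other than i, in order, and then i; it
  -- moves the principal minor i to position 2.
  frame : Fin 3 → Fin 3 → Fin 3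
  frame i zero = punchIn i zero
  frame i (suc zero) = punchIn i (suc zero)
  frame i (suc (suc zero)) = i

  unframe : Fin 3 → Fin 3 → Fin 3
  unframe zero zero = suc (suc zero)
  unframe zero (suc zero) = zero
  unframe zero (suc (suc zero)) = suc zero
  unframe (suc zero) zero = zero
  unframe (suc zero) (suc zero) = suc (suc zero)
  unframe (suc zero) (suc (suc zero)) = suc zero
  unframe (suc (suc zero)) r = r

  frame-unframe : ∀ i r → frame i (unframe i r) ≡ r
  frame-unframe zero zero = refl
  frame-unframe zero (suc zero) = refl
  frame-unframe zero (suc (suc zero)) = refl
  frame-unframe (suc zero) zero = refl
  frame-unframe (suc zero) (suc zero) = refl
  frame-unframe (suc zero) (suc (suc zero)) = refl
  frame-unframe (suc (suc zero)) zero = refl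
  frame-unframe (suc (suc zero)) (suc zero) = refl
  frame-unframe (suc (suc zero)) (suc (suc zero)) = refl

  reframe : Fin 3 → Vector 6 → Vector 6
  reframe i y k = M y (frame i (row k)) (frame i (col k))

  reframe-entries : ∀ i y r s → M (reframe i y) r s ≡ M y (frame i r) (frame i s)
  reframe-entries i y = symmetric-ext (M-symmetric (reframe i y)) (λ r s → M-symmetric y (frame i r) (frame i s))
                                      (M-entry (reframe i y))

  reframe-det : ∀ i y → det3 (M (reframe i y)) ≡ det3 (M y)
  reframe-det i y = by-coordinate {P = λ i → det3 (M (reframe i y)) ≡ det3 (M y)}
    (solve 6 (λ y₀ y₁ y₂ y₃ y₄ y₅ → Formal.symDet y₃ y₄ y₁ y₅ y₂ y₀ := Formal.symDet y₀ y₁ y₂ y₃ y₄ y₅)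
           refl (y (# 0)) (y (# 1)) (y (# 2)) (y (# 3)) (y (# 4)) (y (# 5)))
    (solve 6 (λ y₀ y₁ y₂ y₃ y₄ y₅ → Formal.symDet y₀ y₂ y₁ y₅ y₄ y₃ := Formal.symDet y₀ y₁ y₂ y₃ y₄ y₅)
           refl (y (# 0)) (y (# 1)) (y (# 2)) (y (# 3)) (y (# 4)) (y (# 5)))
    refl i

  reframe-minor : ∀ i y → det2 (minor (# 2) (# 2) (M (reframe i y))) ≡ det2 (minor i i (M y))
  reframe-minor i y =
    by-coordinate {P = λ i → det2 (minor (# 2) (# 2) (M (reframe i y))) ≡ det2 (minor i i (M y))} refl refl refl i

  -- Every point satisfying the square criterion at a non-zero principal
  -- minor has a representation: take the explicit one in the frame of i.
  representation : ∀ y i s → det3 (M y) ≡ 0# → - det2 (minor i i (M y)) ≡ s * s →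
                   NonZero (det2 (minor i i (M y))) → Representation (M y)
  representation y i s det≡0 minor≡-s² minor≢0 = record
    { c = c ; l = l ; x = λ r → x (unframe i r) ; e = λ r → e (unframe i r) ; c≢0 = c≢0
    ; represents = λ r r′ → begin
        c * M y r r′
          ≡⟨ cong₂ (λ u v → c * M y u v) (sym (frame-unframe i r)) (sym (frame-unframe i r′)) ⟩
        c * M y (frame i (unframe i r)) (frame i (unframe i r′))
          ≡⟨ cong (c *_) (sym (reframe-entries i y (unframe i r) (unframe i r′))) ⟩
        c * M (reframe i y) (unframe i r) (unframe i r′)
          ≡⟨ represents (unframe i r) (unframe i r′) ⟩
        hypForm l x e (unframe i r) (unframe i r′) ∎ }
    where
      open Representation (standard-representation (reframe i y) s (trans (reframe-det i y) det≡0)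
                             (trans (cong -_ (reframe-minor i y)) minor≡-s²)
                             (λ m≡0 → minor≢0 (trans (sym (reframe-minor i y)) m≡0)))

  coPair-vanishes : ∀ x e → (∀ i → cross x e i ≡ 0#) → ∀ i → coPair i x e ≡ 0#
  coPair-vanishes x e x×e≡0 = by-coordinate (x×e≡0 zero) (trans antisymmetric (trans (cong -_ (x×e≡0 (suc zero))) -0#≈0#))
                                            (x×e≡0 (suc (suc zero)))
    where
      antisymmetric : pair x e zero (suc (suc zero)) ≡ - pair x e (suc (suc zero)) zero
      antisymmetric = solve 4 (λ a b c d → a :* b :- c :* d := :- (c :* d :- a :* b)) refl
                        (x zero) (e (suc (suc zero))) (x (suc (suc zero))) (e zero)

  module Represented (y : Vector 6) (rep : Representation (M y)) where
    open Representation rep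

    a xe : Vector 3
    a = cross x e
    xe r = x r + e r

    -- the principal minors are -c⁻²(coPair)², so a non-zero one forces a ≢ 0
    line≢0 : ∀ i → NonZero (det2 (minor i i (M y))) → NonZeroVec a
    line≢0 i minor≢0 a≡0 = minor≢0 (cancel (nonzero-* c≢0 c≢0) (begin
      (c * c) * det2 (minor i i (M y))         ≡⟨ sym (det2-scale c (M y) i i) ⟩
      det2 (minor i i (λ r s → c * M y r s))   ≡⟨ det2-cong i i represents ⟩
      det2 (minor i i (hypForm l x e))         ≡⟨ minor-hypForm l x e i i ⟩
      - (coPair i x e * coPair i x e)          ≡⟨ cong (λ t → - (t * coPair i x e)) (coPair-vanishes x e a≡0 i) ⟩
      - (0# * coPair i x e)                    ≡⟨ cong -_ (zeroˡ _) ⟩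
      - 0#                                     ≡⟨ -0#≈0# ⟩
      0#                                       ∎))

    x∈a : dot a x ≡ 0#
    x∈a = prove (x ∷ᵥ e ∷ᵥ []) (Formal.dot (Formal.cross X₀ X₁) X₀) 𝟘 refl
    e∈a : dot a e ≡ 0#
    e∈a = prove (x ∷ᵥ e ∷ᵥ []) (Formal.dot (Formal.cross X₀ X₁) X₁) 𝟘 refl
    xe∈a : dot a xe ≡ 0#
    xe∈a = prove (x ∷ᵥ e ∷ᵥ []) (Formal.dot (Formal.cross X₀ X₁) (λ r → X₀ r :+ X₁ r)) 𝟘 refl

    nonzero-points : NonZeroVec a → NonZeroVec x × NonZeroVec e × NonZeroVec xe
    nonzero-points a≢0 =
        (λ x≡0 → a≢0 (cross-vanishes x e (zero-proportionalˡ x e x≡0)))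
      , (λ e≡0 → a≢0 (cross-vanishes x e (zero-proportionalʳ x e e≡0)))
      , (λ xe≡0 → a≢0 (cross-vanishes x e λ r s → trans
          (solve 4 (λ xᵣ xₛ eᵣ eₛ → xᵣ :* eₛ :- xₛ :* eᵣ := (xᵣ :+ eᵣ) :* eₛ :- (xₛ :+ eₛ) :* eᵣ) refl (x r) (x s) (e r) (e s))
          (zero-proportionalˡ xe e xe≡0 r s)))

    -- y = c⁻¹ (l xxᵀ + x eᵀ + e xᵀ) = c⁻¹ ν(x + e) - c⁻¹ ν e + (c⁻¹ l - c⁻¹) ν x
    c⁻¹ : Carrier
    c⁻¹ = inv c c≢0

    spanning : List (Carrier × Vector 6)
    spanning = (c⁻¹ , ν xe) ∷ (- c⁻¹ , ν e) ∷ (c⁻¹ * l - c⁻¹ , ν x) ∷ []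

    span-entry : ∀ k → y k ≡ c⁻¹ * (xe (row k) * xe (col k)) + (- c⁻¹ * (e (row k) * e (col k))
                               + ((c⁻¹ * l - c⁻¹) * (x (row k) * x (col k)) + 0#))
    span-entry k = modulo₂ (solve 8 (λ y c c⁻¹ l xᵣ xₛ eᵣ eₛ →
        y := c⁻¹ :* ((xᵣ :+ eᵣ) :* (xₛ :+ eₛ)) :+ (:- c⁻¹ :* (eᵣ :* eₛ) :+ ((c⁻¹ :* l :- c⁻¹) :* (xᵣ :* xₛ) :+ 𝟘))
             :+ (c :* y :- Formal.hypEntry l xᵣ xₛ eᵣ eₛ) :* c⁻¹ :+ (c :* c⁻¹ :- 𝟙) :* (:- y))
      refl (y k) c c⁻¹ l (x (row k)) (x (col k)) (e (row k)) (e (col k)))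
      (trans (cong (c *_) (sym (M-entry y k))) (represents (row k) (col k))) (inv-right c c≢0)

    span : y ≐ sumV spanning
    span = by-entry (span-entry (# 0)) (span-entry (# 1)) (span-entry (# 2))
                    (span-entry (# 3)) (span-entry (# 4)) (span-entry (# 5))

    -- a conic point ν z on the line through y and ν x is ν x itself: the
    -- matrix c zzᵀ is a combination of xxᵀ and l xxᵀ + x eᵀ + e xᵀ
    tangent : NonZeroVec x → ∀ w → OnConic a w → OnLineThrough (ν x) y w → SamePoint w (ν x)
    tangent x≢0 w (z , _ , _ , w≐νz) (κ , β , w≡) = t * t , λ k → begin
      w k                                ≡⟨ trans (w≐νz k) (ν-entry z k) ⟩
      z (row k) * z (col k)              ≡⟨ cong₂ _*_ (z≡tx (row k)) (z≡tx (col k)) ⟩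
      (t * x (row k)) * (t * x (col k))  ≡⟨ solve 3 (λ t a b → (t :* a) :* (t :* b) := (t :* t) :* (a :* b)) refl t (x (row k)) (x (col k)) ⟩
      (t * t) * (x (row k) * x (col k))  ≡⟨ cong ((t * t) *_) (sym (ν-entry x k)) ⟩
      (t * t) * ν x k                    ∎
      where
        zzᵀ : ∀ r s → z r * z s ≡ κ * (x r * x s) + β * M y r s
        zzᵀ = symmetric-ext (outer-symmetric z)
                (λ r s → cong₂ (λ u v → κ * u + β * v) (outer-symmetric x r s) (M-symmetric y r s)) λ k → begin
          z (row k) * z (col k)                                  ≡⟨ sym (trans (w≐νz k) (ν-entry z k)) ⟩
          w k                                                    ≡⟨ w≡ k ⟩
          κ * ν x k + β * y k                                    ≡⟨ cong₂ (λ u v → κ * u + β * v) (ν-entry x k) (sym (M-entry y k)) ⟩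
          κ * (x (row k) * x (col k)) + β * M y (row k) (col k)  ∎
        czzᵀ : ∀ r s → c * (z r * z s) ≡ (c * κ) * (x r * x s) + β * hypForm l x e r s
        czzᵀ r s = begin
          c * (z r * z s)                                ≡⟨ cong (c *_) (zzᵀ r s) ⟩
          c * (κ * (x r * x s) + β * M y r s)            ≡⟨ solve 5 (λ c κ β p m → c :* (κ :* p :+ β :* m) := (c :* κ) :* p :+ β :* (c :* m))
                                                              refl c κ β (x r * x s) (M y r s) ⟩
          (c * κ) * (x r * x s) + β * (c * M y r s)      ≡⟨ cong (λ u → (c * κ) * (x r * x s) + β * u) (represents r s) ⟩
          (c * κ) * (x r * x s) + β * hypForm l x e r s  ∎
        proportional : Σ Carrier λ t → ∀ r → z r ≡ t * x r
        proportional = multiple x z x≢0 (tangent-proportional c (c * κ) β l x e z c≢0 czzᵀ)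
        t : Carrier
        t = proj₁ proportional
        z≡tx : ∀ r → z r ≡ t * x r
        z≡tx = proj₂ proportional

    -- with det M_y = 0 and a non-zero principal minor, y lies in P₂,ₑ with
    -- conic ν(x × e), spanned by ν(x + e), ν e, ν x, tangent at ν x
    in-P2e : det3 (M y) ≡ 0# → ∀ i → NonZero (det2 (minor i i (M y))) → P2e y
    in-P2e det≡0 i minor≢0 =
      (det≡0 , i , i , minor≢0) , a , a≢0 , (spanning , onConic , span) ,
      ν x , (x , x≢0 , x∈a , λ _ → refl) , tangent x≢0
      where
        a≢0 : NonZeroVec a
        a≢0 = line≢0 i minor≢0
        x≢0 : NonZeroVec x
        x≢0 = proj₁ (nonzero-points a≢0)
        onConic : All (λ q → OnConic a (proj₂ q)) spanning
        onConic = (xe , proj₂ (proj₂ (nonzero-points a≢0)) , xe∈a , λ _ → refl)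
                ∷ (e , proj₁ (proj₂ (nonzero-points a≢0)) , e∈a , λ _ → refl)
                ∷ (x , x≢0 , x∈a , λ _ → refl) ∷ []

  backward : ∀ y → SquareCriterion y → P2e y
  backward y (det≡0 , (s , -m≡s²) , _ , _ , inj₁ m≢0) =
    Represented.in-P2e y (representation y (# 0) s det≡0 -m≡s² m≢0) det≡0 (# 0) m≢0
  backward y (det≡0 , _ , (s , -m≡s²) , _ , inj₂ (inj₁ m≢0)) =
    Represented.in-P2e y (representation y (# 1) s det≡0 -m≡s² m≢0) det≡0 (# 1) m≢0
  backward y (det≡0 , _ , _ , (s , -m≡s²) , inj₂ (inj₂ m≢0)) =
    Represented.in-P2e y (representation y (# 2) s det≡0 -m≡s² m≢0) det≡0 (# 2) m≢0

  characterisation : ∀ y → P2e y ⇔ SquareCriterion y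
  characterisation y = mk⇔ (forward y) (backward y)

lemma3p7 : (F : FiniteField) → FiniteField.q F % 2 ≡ 1 →
    let open FF F in
    (y : Vector 6) → NonZeroVec y →
    P2e y ⇔
      (det3 (M y) ≡ 0# ×
        IsSquare (- det2 (minor zero zero (M y))) ×
        IsSquare (- det2 (minor (suc zero) (suc zero) (M y))) ×
        IsSquare (- det2 (minor (suc (suc zero)) (suc (suc zero)) (M y))) ×
        (NonZero (det2 (minor zero zero (M y))) ⊎
          NonZero (det2 (minor (suc zero) (suc zero) (M y))) ⊎
          NonZero (det2 (minor (suc (suc zero)) (suc (suc zero)) (M y)))))
lemma3p7 F _ y _ = Proof.characterisation F y
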